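{- There are $O(n)$ Pareto-optimal width-height pairs for the 1-2 drawings of a complete ternary tree with $n$ nodes.
   Context: $T_h$ denotes the complete ternary tree: every non-leaf node has exactly three children and every root-to-leaf path has exactly $h$ nodes; it has $n=(3^h-1)/2$ nodes. A drawing is a planar straight-line orthogonal grid drawing: nodes at distinct integer points, edges horizontal or vertical segments, no crossings; width (height) is the number of vertical (horizontal) grid lines intersecting it. 1-2 drawings of $T_h$ are defined recursively: for $h=1$, a single node at a grid point. For $h\ge2$, take any three (not necessarily congruent) 1-2 drawings $\Gamma^a,\Gamma^b,\Gamma^c$ of $T_{h-1}$ and combine them by Construction 1 or Construction 2. Construction 1: place the root $r$ of $T_h$ at a grid point; translate $\Gamma^a$ so that its topmost grid row is one unit below $r$ and its root is on the vertical line through $r$; rotate $\Gamma^b$ clockwise by $90^\circ$ and place it so its rightmost grid column is one unit left of the leftmost column of $\Gamma^a$, its root on the horizontal line through $r$; rotate $\Gamma^c$ counterclockwise by $90^\circ$ and place it so its leftmost column is one unit right of the rightmost column of $\Gamma^a$, its root on the horizontal line through $r$; connect $r$ to the three roots. Construction 2: place $r$; rotate $\Gamma^b$ clockwise by $90^\circ$ and place it so its rightmost column is one unit left of $r$, its root on the horizontal line through $r$; rotate $\Gamma^c$ counterclockwise by $90^\circ$ and place it so its leftmost column is one unit right of $r$, its root on the horizontal line through $r$; place $\Gamma^a$ so its topmost row is one unit below the lowest row intersecting $\Gamma^b$ or $\Gamma^c$, its root on the vertical line through $r$; connect $r$ to the three roots. A pair $(\omega,\eta)$ is a Pareto-optimal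 width-height pair for the 1-2 drawings of $T_h$ if $T_h$ has a 1-2 drawing with width $\omega$ and height $\eta$, and there is no 1-2 drawing of $T_h$ with width $\omega'\le\omega$ and height $\eta'\le\eta$ where at least one of the two inequalities is strict. -}

module Defs where

open import Data.Nat as ℕ using (ℕ; suc)
open import Data.Nat.DivMod using (_/_)
open import Data.Integer as ℤ using (ℤ; _+_; _-_; -_; _⊓_; _⊔_; ∣_∣; 1ℤ)
open import Data.Product using (_×_; _,_; proj₁; proj₂; Σ)
open import Data.Sum using (_⊎_)
open import Relation.Nullary using (¬_)
open import Relation.Binary.PropositionalEquality using (_≡_)

-- Grid points (x , y); the y-axis points upward ("below" = smaller y).
Point : Set
Point = ℤ × ℤ

-- A placement of the complete ternary tree T_h on grid points:
-- a ternary tree of height h (every root-to-leaf path has h nodes)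
-- whose nodes are labelled by their positions. Edges are the
-- parent-child pairs, drawn as straight segments.
data Tr : ℕ → Set where
  leaf : Point → Tr 1
  node : ∀ {h} → Point → Tr h → Tr h → Tr h → Tr (suc h)

mapTr : ∀ {h} → (Point → Point) → Tr h → Tr h
mapTr f (leaf p) = leaf (f p)
mapTr f (node p a b c) = node (f p) (mapTr f a) (mapTr f b) (mapTr f c)

root : ∀ {h} → Tr h → Point
root (leaf p) = p
root (node p _ _ _) = p

shift : ∀ {h} → ℤ × ℤ → Tr h → Tr h
shift (dx , dy) = mapTr (λ { (x , y) → (x + dx , y + dy) })

rotCW : ∀ {h} → Tr h → Tr h
rotCW = mapTr (λ { (x , y) → (y , - x) })

rotCCW : ∀ {h} → Tr h → Tr h
rotCCW = mapTr (λ { (x , y) → (- y , x) })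

minX maxX minY maxY : ∀ {h} → Tr h → ℤ
minX (leaf p) = proj₁ p
minX (node p a b c) = proj₁ p ⊓ (minX a ⊓ (minX b ⊓ minX c))
maxX (leaf p) = proj₁ p
maxX (node p a b c) = proj₁ p ⊔ (maxX a ⊔ (maxX b ⊔ maxX c))
minY (leaf p) = proj₂ p
minY (node p a b c) = proj₂ p ⊓ (minY a ⊓ (minY b ⊓ minY c))
maxY (leaf p) = proj₂ p
maxY (node p a b c) = proj₂ p ⊔ (maxY a ⊔ (maxY b ⊔ maxY c))

-- number of vertical / horizontal grid lines intersecting the drawing
-- (the drawing is connected, so these are the extents + 1)
width height : ∀ {h} → Tr h → ℕ
width d = suc ∣ maxX d - minX d ∣
height d = suc ∣ maxY d - minY d ∣

-- Construction 1: root r, Γa below r, rotated Γb left of Γa, rotated Γc right of Γa.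
con1 : ∀ {h} → Point → Tr h → Tr h → Tr h → Tr (suc h)
con1 (rx , ry) a b c = node (rx , ry) a' b' c'
  where
  a' = shift (rx - proj₁ (root a) , (ry - 1ℤ) - maxY a) a
  b0 = rotCW b
  b' = shift ((minX a' - 1ℤ) - maxX b0 , ry - proj₂ (root b0)) b0
  c0 = rotCCW c
  c' = shift ((maxX a' + 1ℤ) - minX c0 , ry - proj₂ (root c0)) c0

-- Construction 2: rotated Γb left of r, rotated Γc right of r, Γa below both.
con2 : ∀ {h} → Point → Tr h → Tr h → Tr h → Tr (suc h)
con2 (rx , ry) a b c = node (rx , ry) a' b' c'
  where
  b0 = rotCW b
  b' = shift ((rx - 1ℤ) - maxX b0 , ry - proj₂ (root b0)) b0
  c0 = rotCCW c
  c' = shift ((rx + 1ℤ) - minX c0 , ry - proj₂ (root c0)) c0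
  a' = shift (rx - proj₁ (root a) , ((minY b' ⊓ minY c') - 1ℤ) - maxY a) a

data OneTwo : ∀ {h} → Tr h → Set where
  base : ∀ p → OneTwo (leaf p)
  c1 : ∀ {h} {a b c : Tr h} (r : Point) →
       OneTwo a → OneTwo b → OneTwo c → OneTwo (con1 r a b c)
  c2 : ∀ {h} {a b c : Tr h} (r : Point) →
       OneTwo a → OneTwo b → OneTwo c → OneTwo (con2 r a b c)

nodes : ℕ → ℕ
nodes h = (3 ℕ.^ h ℕ.∸ 1) / 2

Achievable : ℕ → ℕ → ℕ → Set
Achievable h ω η = Σ (Tr h) λ d → OneTwo d × width d ≡ ω × height d ≡ η

ParetoOptimal : ℕ → ℕ → ℕ → Set
ParetoOptimal h ω η =
  Achievable h ω η ×
  (∀ (d : Tr h) → OneTwo d →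
     ¬ (width d ℕ.≤ ω × height d ℕ.≤ η × (width d ℕ.< ω ⊎ height d ℕ.< η)))

module Submission where

-- In a 1-2 drawing of T_{h+1} the span (max − min) of the coordinates along
-- each axis is at most 3^h − 1. Along each axis the four parts of a drawing built
-- by Construction 1 or 2 fit into a band that stretches a core interval of length
-- at most e (the bound for the subtrees) by 1 + e on each side, so the spans obey
-- e' ≤ 3e + 2. Hence every width lies in [1, 3^h]; as two Pareto-optimal pairs
-- with the same width have the same height, there are at most 3^h + 1 ≤ 2n of them.

open import Defs

module Extents where

  open import Data.Nat as ℕ using (ℕ; zero; suc; z≤n; s≤s)
  open import Data.Integer using (ℤ; +_; +≤+; 1ℤ; _+_; _-_; -_; _⊓_; _⊔_; _≤_)
  open import Data.Integer.Properties
  open import Data.Integer.Tactic.RingSolver using (solve-∀)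
  open import Data.Product using (_×_; _,_; proj₁; proj₂)
  open import Function using (id)
  open import Relation.Binary.PropositionalEquality

  i-[i-j]≡j : ∀ i j → i - (i - j) ≡ j
  i-[i-j]≡j = solve-∀

  j+[i-j]≡i : ∀ i j → j + (i - j) ≡ i
  j+[i-j]≡i = solve-∀

  [i+k]-[j+k]≡i-j : ∀ i j k → (i + k) - (j + k) ≡ i - j
  [i+k]-[j+k]≡i-j = solve-∀

  [-j]-[-i]≡i-j : ∀ i j → (- j) - (- i) ≡ i - j
  [-j]-[-i]≡i-j = solve-∀

  i-i≤+n : ∀ i n → i - i ≤ + n
  i-i≤+n i n = ≤-trans (≤-reflexive (+-inverseʳ i)) (+≤+ z≤n)

  -- minX, maxX, minY and maxY are folds of the same shape; abstracting over them
  -- lets extremum-mapTr track all of them through translations and rotations.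
  record Extremum (coord : Point → ℤ) (_∙_ : ℤ → ℤ → ℤ) : Set where
    field
      extremum : ∀ {h} → Tr h → ℤ
      extremum-leaf : ∀ p → extremum (leaf p) ≡ coord p
      extremum-node : ∀ {h} p (a b c : Tr h) →
                      extremum (node p a b c) ≡ coord p ∙ (extremum a ∙ (extremum b ∙ extremum c))

  open Extremum

  extremum-mapTr : ∀ {c₁ c₂ _∙_ _∘_} (E : Extremum c₁ _∙_) (F : Extremum c₂ _∘_)
                   {f : Point → Point} {g : ℤ → ℤ} →
                   (∀ p → c₂ (f p) ≡ g (c₁ p)) → (∀ x y → g (x ∙ y) ≡ g x ∘ g y) →
                   ∀ {h} (t : Tr h) → extremum F (mapTr f t) ≡ g (extremum E t)
  extremum-mapTr {c₁} {c₂} {_∙_} {_∘_} E F {f} {g} f-coord g-distrib = go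
    where
    go : ∀ {h} (t : Tr h) → extremum F (mapTr f t) ≡ g (extremum E t)
    go (leaf p) = trans (extremum-leaf F (f p)) (trans (f-coord p) (cong g (sym (extremum-leaf E p))))
    go (node p a b c) = begin
        extremum F (node (f p) (mapTr f a) (mapTr f b) (mapTr f c))
      ≡⟨ extremum-node F _ _ _ _ ⟩
        c₂ (f p) ∘ (extremum F (mapTr f a) ∘ (extremum F (mapTr f b) ∘ extremum F (mapTr f c)))
      ≡⟨ cong₂ _∘_ (f-coord p) (cong₂ _∘_ (go a) (cong₂ _∘_ (go b) (go c))) ⟩
        g (c₁ p) ∘ (g (extremum E a) ∘ (g (extremum E b) ∘ g (extremum E c)))
      ≡⟨ cong (g (c₁ p) ∘_) (cong (g (extremum E a) ∘_) (g-distrib _ _)) ⟨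
        g (c₁ p) ∘ (g (extremum E a) ∘ g (extremum E b ∙ extremum E c))
      ≡⟨ cong (g (c₁ p) ∘_) (g-distrib _ _) ⟨
        g (c₁ p) ∘ g (extremum E a ∙ (extremum E b ∙ extremum E c))
      ≡⟨ g-distrib _ _ ⟨
        g (c₁ p ∙ (extremum E a ∙ (extremum E b ∙ extremum E c)))
      ≡⟨ cong g (extremum-node E p a b c) ⟨
        g (extremum E (node p a b c))
      ∎
      where open ≡-Reasoning

  minXₑ : Extremum proj₁ _⊓_
  minXₑ = record { extremum = minX ; extremum-leaf = λ _ → refl ; extremum-node = λ _ _ _ _ → refl }

  maxXₑ : Extremum proj₁ _⊔_
  maxXₑ = record { extremum = maxX ; extremum-leaf = λ _ → refl ; extremum-node = λ _ _ _ _ → refl }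

  minYₑ : Extremum proj₂ _⊓_
  minYₑ = record { extremum = minY ; extremum-leaf = λ _ → refl ; extremum-node = λ _ _ _ _ → refl }

  maxYₑ : Extremum proj₂ _⊔_
  maxYₑ = record { extremum = maxY ; extremum-leaf = λ _ → refl ; extremum-node = λ _ _ _ _ → refl }

  record Axis : Set where
    field
      coord : Point → ℤ
      lowₑ : Extremum coord _⊓_
      highₑ : Extremum coord _⊔_

    low high span : ∀ {h} → Tr h → ℤ
    low = extremum lowₑ
    high = extremum highₑ
    span t = high t - low t

    low≤root : ∀ {h} (t : Tr h) → low t ≤ coord (root t)
    low≤root (leaf p) = ≤-reflexive (extremum-leaf lowₑ p)
    low≤root (node p a b c) = ≤-trans (≤-reflexive (extremum-node lowₑ p a b c)) (i⊓j≤i _ _)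

    root≤high : ∀ {h} (t : Tr h) → coord (root t) ≤ high t
    root≤high (leaf p) = ≤-reflexive (sym (extremum-leaf highₑ p))
    root≤high (node p a b c) = ≤-trans (i≤i⊔j _ _) (≤-reflexive (sym (extremum-node highₑ p a b c)))

    low≤high : ∀ {h} (t : Tr h) → low t ≤ high t
    low≤high t = ≤-trans (low≤root t) (root≤high t)

  xAxis yAxis : Axis
  xAxis = record { coord = proj₁ ; lowₑ = minXₑ ; highₑ = maxXₑ }
  yAxis = record { coord = proj₂ ; lowₑ = minYₑ ; highₑ = maxYₑ }

  record Within (A : Axis) {h} (lo hi : ℤ) (t : Tr h) : Set where
    constructor within
    open Axis A
    field
      lo≤low : lo ≤ low t
      high≤hi : high t ≤ hi

  module _ (A : Axis) where
    open Axis A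

    Within⇒span≤ : ∀ {h lo hi} {t : Tr h} → Within A lo hi t → span t ≤ hi - lo
    Within⇒span≤ (within lo≤ ≤hi) = +-mono-≤ ≤hi (neg-mono-≤ lo≤)

    Within-widen : ∀ {h lo lo' hi hi'} {t : Tr h} → lo' ≤ lo → hi ≤ hi' → Within A lo hi t → Within A lo' hi' t
    Within-widen lo'≤lo hi≤hi' (within lo≤ ≤hi) = within (≤-trans lo'≤lo lo≤) (≤-trans ≤hi hi≤hi')

    Within-node : ∀ {h lo hi} p {a b c : Tr h} → lo ≤ coord p → coord p ≤ hi →
                  Within A lo hi a → Within A lo hi b → Within A lo hi c → Within A lo hi (node p a b c)
    Within-node p {a} {b} {c} lo≤p p≤hi (within lo≤a a≤hi) (within lo≤b b≤hi) (within lo≤c c≤hi) = within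
      (subst (_ ≤_) (sym (extremum-node lowₑ p a b c)) (⊓-glb lo≤p (⊓-glb lo≤a (⊓-glb lo≤b lo≤c))))
      (subst (_≤ _) (sym (extremum-node highₑ p a b c)) (⊔-lub p≤hi (⊔-lub a≤hi (⊔-lub b≤hi c≤hi))))

    Within-hull : ∀ {h} (t : Tr h) → Within A (low t) (high t) t
    Within-hull t = within ≤-refl ≤-refl

    module _ {h E} (t : Tr h) (span≤E : span t ≤ E) where

      high-E≤low : high t - E ≤ low t
      high-E≤low = begin
        high t - E                 ≤⟨ +-monoʳ-≤ (high t) (neg-mono-≤ span≤E) ⟩
        high t - (high t - low t)  ≡⟨ i-[i-j]≡j (high t) (low t) ⟩
        low t                      ∎
        where open ≤-Reasoning

      high≤low+E : high t ≤ low t + E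
      high≤low+E = begin
        high t          ≡⟨ j+[i-j]≡i (high t) (low t) ⟨
        low t + span t  ≤⟨ +-monoʳ-≤ (low t) span≤E ⟩
        low t + E       ∎
        where open ≤-Reasoning

      Within-below : ∀ {v} → high t ≡ v → Within A (v - E) v t
      Within-below refl = within high-E≤low ≤-refl

      Within-above : ∀ {v} → low t ≡ v → Within A v (v + E) t
      Within-above refl = within ≤-refl high≤low+E

      Within-around : ∀ {v} → coord (root t) ≡ v → Within A (v - E) (v + E) t
      Within-around refl = within
        (≤-trans (+-monoˡ-≤ (- E) (root≤high t)) high-E≤low)
        (≤-trans high≤low+E (+-monoˡ-≤ E (low≤root t)))

  open Axis

  SpansAtMost : ∀ {h} → ℤ → Tr h → Set
  SpansAtMost E t = span xAxis t ≤ E × span yAxis t ≤ E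

  root-mapTr : ∀ {h} f (t : Tr h) → root (mapTr f t) ≡ f (root t)
  root-mapTr f (leaf p) = refl
  root-mapTr f (node p _ _ _) = refl

  module _ {h} (d : ℤ × ℤ) (t : Tr h) where

    minX-shift : minX (shift d t) ≡ minX t + proj₁ d
    minX-shift = extremum-mapTr minXₑ minXₑ (λ _ → refl) (mono-≤-distrib-⊓ (+-monoˡ-≤ (proj₁ d))) t

    maxX-shift : maxX (shift d t) ≡ maxX t + proj₁ d
    maxX-shift = extremum-mapTr maxXₑ maxXₑ (λ _ → refl) (mono-≤-distrib-⊔ (+-monoˡ-≤ (proj₁ d))) t

    minY-shift : minY (shift d t) ≡ minY t + proj₂ d
    minY-shift = extremum-mapTr minYₑ minYₑ (λ _ → refl) (mono-≤-distrib-⊓ (+-monoˡ-≤ (proj₂ d))) t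

    maxY-shift : maxY (shift d t) ≡ maxY t + proj₂ d
    maxY-shift = extremum-mapTr maxYₑ maxYₑ (λ _ → refl) (mono-≤-distrib-⊔ (+-monoˡ-≤ (proj₂ d))) t

    root-shift : root (shift d t) ≡ (proj₁ (root t) + proj₁ d , proj₂ (root t) + proj₂ d)
    root-shift = root-mapTr _ t

    SpansAtMost-shift : ∀ {E} → SpansAtMost E t → SpansAtMost E (shift d t)
    SpansAtMost-shift (x≤E , y≤E) =
      subst (_≤ _) (sym (trans (cong₂ _-_ maxX-shift minX-shift) ([i+k]-[j+k]≡i-j (maxX t) (minX t) (proj₁ d))))
            x≤E ,
      subst (_≤ _) (sym (trans (cong₂ _-_ maxY-shift minY-shift) ([i+k]-[j+k]≡i-j (maxY t) (minY t) (proj₂ d))))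
            y≤E

  module _ {h} {E : ℤ} (t : Tr h) where

    SpansAtMost-rotCW : SpansAtMost E t → SpansAtMost E (rotCW t)
    SpansAtMost-rotCW (x≤E , y≤E) = subst (_≤ E) (sym x-span) y≤E , subst (_≤ E) (sym y-span) x≤E
      where
      x-span : span xAxis (rotCW t) ≡ span yAxis t
      x-span = cong₂ _-_ (extremum-mapTr maxYₑ maxXₑ {g = id} (λ _ → refl) (λ _ _ → refl) t)
                         (extremum-mapTr minYₑ minXₑ {g = id} (λ _ → refl) (λ _ _ → refl) t)
      y-span : span yAxis (rotCW t) ≡ span xAxis t
      y-span = trans (cong₂ _-_ (extremum-mapTr minXₑ maxYₑ (λ _ → refl) neg-distrib-⊓-⊔ t)
                                (extremum-mapTr maxXₑ minYₑ (λ _ → refl) neg-distrib-⊔-⊓ t))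
                     ([-j]-[-i]≡i-j (maxX t) (minX t))

    SpansAtMost-rotCCW : SpansAtMost E t → SpansAtMost E (rotCCW t)
    SpansAtMost-rotCCW (x≤E , y≤E) = subst (_≤ E) (sym x-span) y≤E , subst (_≤ E) (sym y-span) x≤E
      where
      x-span : span xAxis (rotCCW t) ≡ span yAxis t
      x-span = trans (cong₂ _-_ (extremum-mapTr minYₑ maxXₑ (λ _ → refl) neg-distrib-⊓-⊔ t)
                                (extremum-mapTr maxYₑ minXₑ (λ _ → refl) neg-distrib-⊔-⊓ t))
                     ([-j]-[-i]≡i-j (maxY t) (minY t))
      y-span : span yAxis (rotCCW t) ≡ span xAxis t
      y-span = cong₂ _-_ (extremum-mapTr maxXₑ maxYₑ {g = id} (λ _ → refl) (λ _ _ → refl) t)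
                         (extremum-mapTr minXₑ minYₑ {g = id} (λ _ → refl) (λ _ _ → refl) t)

  -- The core [i, j] is the extent of Γᵃ (Construction 1, horizontally), the
  -- root alone (Construction 1 vertically, Construction 2 horizontally), or
  -- [lowest point of the side subtrees, root] (Construction 2, vertically).
  module Band (e : ℕ) (i j : ℤ) where

    lo hi : ℤ
    lo = (i - 1ℤ) - + e
    hi = (j + 1ℤ) + + e

    lo≤ : ∀ {k} → i ≤ k → lo ≤ k
    lo≤ i≤k = i≤j⇒i-k≤j (+ e) (i≤j⇒i-k≤j 1ℤ i≤k)

    ≤hi : ∀ {k} → k ≤ j → k ≤ hi
    ≤hi k≤j = ≤-trans (≤-trans k≤j (i≤i+j j 1ℤ)) (i≤i+j _ (+ e))

    lo≤-e : ∀ {k} → i ≤ k → lo ≤ k - + e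
    lo≤-e i≤k = +-monoˡ-≤ (- + e) (i≤j⇒i-k≤j 1ℤ i≤k)

    +e≤hi : ∀ {k} → k ≤ j → k + + e ≤ hi
    +e≤hi k≤j = +-monoˡ-≤ (+ e) (≤-trans k≤j (i≤i+j j 1ℤ))

    hi-lo≤ : j - i ≤ + e → hi - lo ≤ + e + + e + + e + + 2
    hi-lo≤ j-i≤e = begin
      hi - lo                         ≡⟨ rearrange i j (+ e) ⟩
      (j - i) + + e + + e + + 2       ≤⟨ +-monoˡ-≤ (+ 2) (+-monoˡ-≤ (+ e) (+-monoˡ-≤ (+ e) j-i≤e)) ⟩
      + e + + e + + e + + 2           ∎
      where
      open ≤-Reasoning
      rearrange : ∀ i j E → ((j + 1ℤ) + E) - ((i - 1ℤ) - E) ≡ (j - i) + E + E + + 2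
      rearrange = solve-∀

    span-node≤ : ∀ A {h} p {a b c : Tr h} → j - i ≤ + e →
                 lo ≤ coord A p → coord A p ≤ hi → Within A lo hi a → Within A lo hi b → Within A lo hi c →
                 span A (node p a b c) ≤ + e + + e + + e + + 2
    span-node≤ A p j-i≤e lo≤p p≤hi a-in b-in c-in =
      ≤-trans (Within⇒span≤ A (Within-node A p lo≤p p≤hi a-in b-in c-in)) (hi-lo≤ j-i≤e)

  module _ (e : ℕ) where

    SpansAtMost-con1 : ∀ {h} r {a b c : Tr h} →
                       SpansAtMost (+ e) a → SpansAtMost (+ e) b → SpansAtMost (+ e) c →
                       SpansAtMost (+ e + + e + + e + + 2) (con1 r a b c)
    SpansAtMost-con1 {h} (rx , ry) {a} {b} {c} sa sb sc = x-span , y-span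
      where
      a' b0 b' c0 c' : Tr h
      a' = shift (rx - proj₁ (root a) , (ry - 1ℤ) - maxY a) a
      b0 = rotCW b
      b' = shift ((minX a' - 1ℤ) - maxX b0 , ry - proj₂ (root b0)) b0
      c0 = rotCCW c
      c' = shift ((maxX a' + 1ℤ) - minX c0 , ry - proj₂ (root c0)) c0

      a'-spans : SpansAtMost (+ e) a'
      a'-spans = SpansAtMost-shift _ a sa
      b'-spans : SpansAtMost (+ e) b'
      b'-spans = SpansAtMost-shift _ b0 (SpansAtMost-rotCW b sb)
      c'-spans : SpansAtMost (+ e) c'
      c'-spans = SpansAtMost-shift _ c0 (SpansAtMost-rotCCW c sc)

      a'-root : proj₁ (root a') ≡ rx
      a'-root = trans (cong proj₁ (root-shift _ a)) (j+[i-j]≡i rx (proj₁ (root a)))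
      a'-top : maxY a' ≡ ry - 1ℤ
      a'-top = trans (maxY-shift _ a) (j+[i-j]≡i (ry - 1ℤ) (maxY a))
      b'-right : maxX b' ≡ minX a' - 1ℤ
      b'-right = trans (maxX-shift _ b0) (j+[i-j]≡i (minX a' - 1ℤ) (maxX b0))
      b'-root : proj₂ (root b') ≡ ry
      b'-root = trans (cong proj₂ (root-shift _ b0)) (j+[i-j]≡i ry (proj₂ (root b0)))
      c'-left : minX c' ≡ maxX a' + 1ℤ
      c'-left = trans (minX-shift _ c0) (j+[i-j]≡i (maxX a' + 1ℤ) (minX c0))
      c'-root : proj₂ (root c') ≡ ry
      c'-root = trans (cong proj₂ (root-shift _ c0)) (j+[i-j]≡i ry (proj₂ (root c0)))

      x-span : span xAxis (con1 (rx , ry) a b c) ≤ + e + + e + + e + + 2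
      x-span = span-node≤ xAxis (rx , ry) {a'} {b'} {c'} (proj₁ a'-spans) lo≤rx rx≤hi a'-in b'-in c'-in
        where
        open Band e (minX a') (maxX a')
        lo≤rx : lo ≤ rx
        lo≤rx = lo≤ (subst (minX a' ≤_) a'-root (low≤root xAxis a'))
        rx≤hi : rx ≤ hi
        rx≤hi = ≤hi (subst (_≤ maxX a') a'-root (root≤high xAxis a'))
        a'-in : Within xAxis lo hi a'
        a'-in = Within-widen xAxis (lo≤ ≤-refl) (≤hi ≤-refl) (Within-hull xAxis a')
        b'-in : Within xAxis lo hi b'
        b'-in = Within-widen xAxis ≤-refl (≤hi (≤-trans (i-j≤i _ 1ℤ) (low≤high xAxis a')))
                  (Within-below xAxis b' (proj₁ b'-spans) b'-right)
        c'-in : Within xAxis lo hi c'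
        c'-in = Within-widen xAxis (lo≤ (≤-trans (low≤high xAxis a') (i≤i+j _ 1ℤ))) ≤-refl
                  (Within-above xAxis c' (proj₁ c'-spans) c'-left)

      y-span : span yAxis (con1 (rx , ry) a b c) ≤ + e + + e + + e + + 2
      y-span = span-node≤ yAxis (rx , ry) {a'} {b'} {c'} (i-i≤+n ry e) (lo≤ ≤-refl) (≤hi ≤-refl) a'-in b'-in c'-in
        where
        open Band e ry ry
        a'-in : Within yAxis lo hi a'
        a'-in = Within-widen yAxis ≤-refl (≤hi (i-j≤i ry 1ℤ)) (Within-below yAxis a' (proj₂ a'-spans) a'-top)
        b'-in : Within yAxis lo hi b'
        b'-in = Within-widen yAxis (lo≤-e ≤-refl) (+e≤hi ≤-refl) (Within-around yAxis b' (proj₂ b'-spans) b'-root)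
        c'-in : Within yAxis lo hi c'
        c'-in = Within-widen yAxis (lo≤-e ≤-refl) (+e≤hi ≤-refl) (Within-around yAxis c' (proj₂ c'-spans) c'-root)

    SpansAtMost-con2 : ∀ {h} r {a b c : Tr h} →
                       SpansAtMost (+ e) a → SpansAtMost (+ e) b → SpansAtMost (+ e) c →
                       SpansAtMost (+ e + + e + + e + + 2) (con2 r a b c)
    SpansAtMost-con2 {h} (rx , ry) {a} {b} {c} sa sb sc = x-span , y-span
      where
      a' b0 b' c0 c' : Tr h
      b0 = rotCW b
      b' = shift ((rx - 1ℤ) - maxX b0 , ry - proj₂ (root b0)) b0
      c0 = rotCCW c
      c' = shift ((rx + 1ℤ) - minX c0 , ry - proj₂ (root c0)) c0
      m : ℤ
      m = minY b' ⊓ minY c'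
      a' = shift (rx - proj₁ (root a) , (m - 1ℤ) - maxY a) a

      a'-spans : SpansAtMost (+ e) a'
      a'-spans = SpansAtMost-shift _ a sa
      b'-spans : SpansAtMost (+ e) b'
      b'-spans = SpansAtMost-shift _ b0 (SpansAtMost-rotCW b sb)
      c'-spans : SpansAtMost (+ e) c'
      c'-spans = SpansAtMost-shift _ c0 (SpansAtMost-rotCCW c sc)

      b'-right : maxX b' ≡ rx - 1ℤ
      b'-right = trans (maxX-shift _ b0) (j+[i-j]≡i (rx - 1ℤ) (maxX b0))
      b'-root : proj₂ (root b') ≡ ry
      b'-root = trans (cong proj₂ (root-shift _ b0)) (j+[i-j]≡i ry (proj₂ (root b0)))
      c'-left : minX c' ≡ rx + 1ℤ
      c'-left = trans (minX-shift _ c0) (j+[i-j]≡i (rx + 1ℤ) (minX c0))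
      c'-root : proj₂ (root c') ≡ ry
      c'-root = trans (cong proj₂ (root-shift _ c0)) (j+[i-j]≡i ry (proj₂ (root c0)))
      a'-root : proj₁ (root a') ≡ rx
      a'-root = trans (cong proj₁ (root-shift _ a)) (j+[i-j]≡i rx (proj₁ (root a)))
      a'-top : maxY a' ≡ m - 1ℤ
      a'-top = trans (maxY-shift _ a) (j+[i-j]≡i (m - 1ℤ) (maxY a))

      x-span : span xAxis (con2 (rx , ry) a b c) ≤ + e + + e + + e + + 2
      x-span = span-node≤ xAxis (rx , ry) {a'} {b'} {c'} (i-i≤+n rx e) (lo≤ ≤-refl) (≤hi ≤-refl) a'-in b'-in c'-in
        where
        open Band e rx rx
        a'-in : Within xAxis lo hi a'
        a'-in = Within-widen xAxis (lo≤-e ≤-refl) (+e≤hi ≤-refl) (Within-around xAxis a' (proj₁ a'-spans) a'-root)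
        b'-in : Within xAxis lo hi b'
        b'-in = Within-widen xAxis ≤-refl (≤hi (i-j≤i rx 1ℤ)) (Within-below xAxis b' (proj₁ b'-spans) b'-right)
        c'-in : Within xAxis lo hi c'
        c'-in = Within-widen xAxis (lo≤ (i≤i+j rx 1ℤ)) ≤-refl (Within-above xAxis c' (proj₁ c'-spans) c'-left)

      b'-around : Within yAxis (ry - + e) (ry + + e) b'
      b'-around = Within-around yAxis b' (proj₂ b'-spans) b'-root
      c'-around : Within yAxis (ry - + e) (ry + + e) c'
      c'-around = Within-around yAxis c' (proj₂ c'-spans) c'-root
      m≤ry : m ≤ ry
      m≤ry = ≤-trans (i⊓j≤i _ _) (subst (minY b' ≤_) b'-root (low≤root yAxis b'))
      ry-m≤e : ry - m ≤ + e
      ry-m≤e = begin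
        ry - m           ≤⟨ +-monoʳ-≤ ry (neg-mono-≤ (⊓-glb (Within.lo≤low b'-around) (Within.lo≤low c'-around))) ⟩
        ry - (ry - + e)  ≡⟨ i-[i-j]≡j ry (+ e) ⟩
        + e              ∎
        where open ≤-Reasoning

      y-span : span yAxis (con2 (rx , ry) a b c) ≤ + e + + e + + e + + 2
      y-span = span-node≤ yAxis (rx , ry) {a'} {b'} {c'} ry-m≤e (lo≤ m≤ry) (≤hi ≤-refl) a'-in b'-in c'-in
        where
        open Band e m ry
        a'-in : Within yAxis lo hi a'
        a'-in = Within-widen yAxis ≤-refl (≤hi (≤-trans (i-j≤i m 1ℤ) m≤ry))
            (Within-below yAxis a' (proj₂ a'-spans) a'-top)
        b'-in : Within yAxis lo hi b'
        b'-in = Within-widen yAxis (lo≤-e m≤ry) (+e≤hi ≤-refl) b'-around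
        c'-in : Within yAxis lo hi c'
        c'-in = Within-widen yAxis (lo≤-e m≤ry) (+e≤hi ≤-refl) c'-around

  maxSpan : ℕ → ℕ
  maxSpan zero = 0
  maxSpan (suc h) = maxSpan h ℕ.+ maxSpan h ℕ.+ maxSpan h ℕ.+ 2

  OneTwo⇒SpansAtMost : ∀ {h} {d : Tr (suc h)} → OneTwo d → SpansAtMost (+ maxSpan h) d
  OneTwo⇒SpansAtMost (base (x , y)) = i-i≤+n x 0 , i-i≤+n y 0
  OneTwo⇒SpansAtMost (c1 {zero} _ () _ _)
  OneTwo⇒SpansAtMost (c1 {suc h} {a} {b} {c} r da db dc) =
    SpansAtMost-con1 (maxSpan h) r {a} {b} {c} (OneTwo⇒SpansAtMost da) (OneTwo⇒SpansAtMost db) (OneTwo⇒SpansAtMost dc)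
  OneTwo⇒SpansAtMost (c2 {zero} _ () _ _)
  OneTwo⇒SpansAtMost (c2 {suc h} {a} {b} {c} r da db dc) =
    SpansAtMost-con2 (maxSpan h) r {a} {b} {c} (OneTwo⇒SpansAtMost da) (OneTwo⇒SpansAtMost db) (OneTwo⇒SpansAtMost dc)

  SpansAtMost⇒width≤ : ∀ {h n} (d : Tr h) → SpansAtMost (+ n) d → width d ℕ.≤ suc n
  SpansAtMost⇒width≤ {n = n} d (x-span≤n , _) =
    s≤s (drop‿+≤+ (subst (_≤ + n) (sym (0≤i⇒+∣i∣≡i (i≤j⇒0≤j-i (low≤high xAxis d)))) x-span≤n))


open import Data.Nat using (ℕ; zero; suc; _≤_; _<_; _*_; _+_; _∸_; _^_; s≤s)
open import Data.Nat.Properties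
  using ( ≤-refl; ≤-reflexive; ≤-trans; ≤-antisym; <⇒≤; ≮⇒≥; +-monoˡ-≤; +-monoʳ-≤; +-mono-≤; +-identityʳ
        ; m+n≤o⇒m≤o∸n; m^n>0; module ≤-Reasoning)
open import Data.Nat.DivMod using (_/_; m*n/n≡m; /-monoˡ-≤)
open import Data.Nat.Tactic.RingSolver using (solve-∀)
open import Data.Fin using (Fin; zero; suc; fromℕ<)
open import Data.Fin.Properties using (injective⇒≤; fromℕ<-injective)
open import Data.Product using (Σ; _×_; _,_; proj₁; proj₂)
open import Data.Sum using (inj₂)
open import Data.List using (List; length; lookup)
open import Data.List.Membership.Propositional.Properties using (∈-lookup)
open import Data.List.Relation.Unary.All as All using (All)
open import Data.List.Relation.Unary.AllPairs using (_∷_)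
open import Data.List.Relation.Unary.Unique.Propositional using (Unique)
open import Relation.Binary.PropositionalEquality using (_≡_; refl; sym; trans; cong)
open import Relation.Nullary using (¬_; contradiction)
open import Relation.Unary using (Pred)

open Extents using (maxSpan; OneTwo⇒SpansAtMost; SpansAtMost⇒width≤)

suc-maxSpan : ∀ h → suc (maxSpan h) ≡ 3 ^ h
suc-maxSpan zero = refl
suc-maxSpan (suc h) = trans (triple (maxSpan h)) (cong (3 *_) (suc-maxSpan h))
  where
  triple : ∀ m → suc (m + m + m + 2) ≡ 3 * suc m
  triple = solve-∀

OneTwo⇒width≤3^h : ∀ {h} {d : Tr (suc h)} → OneTwo d → width d ≤ 3 ^ h
OneTwo⇒width≤3^h {h} {d} od =
  ≤-trans (SpansAtMost⇒width≤ d (OneTwo⇒SpansAtMost od)) (≤-reflexive (suc-maxSpan h))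

3^h≤nodes[1+h] : ∀ h → 3 ^ h ≤ nodes (suc h)
3^h≤nodes[1+h] h = begin
  t                  ≡⟨ m*n/n≡m t 2 ⟨
  t * 2 / 2          ≤⟨ /-monoˡ-≤ 2 (m+n≤o⇒m≤o∸n (t * 2) 2t+1≤3t) ⟩
  (3 * t ∸ 1) / 2    ∎
  where
  open ≤-Reasoning
  t = 3 ^ h
  2t+1≤3t : t * 2 + 1 ≤ 3 * t
  2t+1≤3t = ≤-trans (+-monoʳ-≤ (t * 2) (m^n>0 3 h)) (≤-reflexive (triple t))
    where
    triple : ∀ t → t * 2 + t ≡ 3 * t
    triple = solve-∀

ParetoOptimal-width-injective : ∀ {h} {p q : ℕ × ℕ} →
  ParetoOptimal h (proj₁ p) (proj₂ p) → ParetoOptimal h (proj₁ q) (proj₂ q) → proj₁ p ≡ proj₁ q → p ≡ q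
ParetoOptimal-width-injective {p = ω , η} {q = .ω , η'} p-opt q-opt refl =
  cong (ω ,_) (≤-antisym (≮⇒≥ (not-below p-opt (proj₁ q-opt))) (≮⇒≥ (not-below q-opt (proj₁ p-opt))))
  where
  not-below : ∀ {h ω η η'} → ParetoOptimal h ω η → Achievable h ω η' → ¬ η' < η
  not-below (_ , optimal) (d , od , refl , refl) η'<η = optimal d od (≤-refl , <⇒≤ η'<η , inj₂ η'<η)

module _ {a} {A : Set a} where

  Unique-lookup-injective : ∀ {xs : List A} → Unique xs → ∀ i j → lookup xs i ≡ lookup xs j → i ≡ j
  Unique-lookup-injective (_ ∷ _) zero zero _ = refl
  Unique-lookup-injective (x∉xs ∷ _) zero (suc j) eq = contradiction eq (All.lookup x∉xs (∈-lookup j))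
  Unique-lookup-injective (x∉xs ∷ _) (suc i) zero eq = contradiction (sym eq) (All.lookup x∉xs (∈-lookup i))
  Unique-lookup-injective (_ ∷ unique) (suc i) (suc j) eq = cong suc (Unique-lookup-injective unique i j eq)

  keys-injective⇒length≤ : ∀ {p} {P : Pred A p} {n} (key : A → ℕ) →
    (∀ {x} → P x → key x < n) → (∀ {x y} → P x → P y → key x ≡ key y → x ≡ y) →
    ∀ {xs} → Unique xs → All P xs → length xs ≤ n
  keys-injective⇒length≤ {P = P} {n} key key< key-injective {xs} unique all-P = injective⇒≤ index-injective
    where
    P-at : ∀ i → P (lookup xs i)
    P-at i = All.lookup all-P (∈-lookup i)
    index : Fin (length xs) → Fin n
    index i = fromℕ< (key< (P-at i))
    index-injective : ∀ {i j} → index i ≡ index j → i ≡ j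
    index-injective {i} {j} eq = Unique-lookup-injective unique i j
      (key-injective (P-at i) (P-at j) (fromℕ<-injective _ _ (key< (P-at i)) (key< (P-at j)) eq))

lemma4 : Σ ℕ λ C → Σ ℕ λ n₀ → ∀ (h : ℕ) → n₀ ≤ nodes h →
           ∀ (ps : List (ℕ × ℕ)) → Unique ps →
           All (λ p → ParetoOptimal h (proj₁ p) (proj₂ p)) ps →
           length ps ≤ C * nodes h
lemma4 = 2 , 1 , bound
  where
  bound : ∀ h → 1 ≤ nodes h → ∀ (ps : List (ℕ × ℕ)) → Unique ps →
          All (λ p → ParetoOptimal h (proj₁ p) (proj₂ p)) ps → length ps ≤ 2 * nodes h
  bound zero ()
  bound (suc h) _ ps unique optimal = begin
    length ps                    ≤⟨ keys-injective⇒length≤ proj₁ width< ParetoOptimal-width-injective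
                                                            unique optimal ⟩
    1 + 3 ^ h                    ≤⟨ +-monoˡ-≤ (3 ^ h) (m^n>0 3 h) ⟩
    3 ^ h + 3 ^ h                ≤⟨ +-mono-≤ (3^h≤nodes[1+h] h) (3^h≤nodes[1+h] h) ⟩
    nodes (suc h) + nodes (suc h) ≡⟨ cong (nodes (suc h) +_) (+-identityʳ (nodes (suc h))) ⟨
    2 * nodes (suc h)            ∎
    where
    open ≤-Reasoning
    width< : ∀ {p} → ParetoOptimal (suc h) (proj₁ p) (proj₂ p) → proj₁ p < suc (3 ^ h)
    width< ((_ , od , refl , _) , _) = s≤s (OneTwo⇒width≤3^h od)
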